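{- Let $E$ and $F$ be finite sets. A subset $\mathcal{RR}^\updownarrow\subseteq 2^E\times 2^F$ is the set of vertical regular rectangles of a bimatroid $\mathsf{A}$ on $E\times F$ if and only if: (1) $(\emptyset,\emptyset)\in\mathcal{RR}^\updownarrow$; (2) every $(S,T)\in\mathcal{RR}^\updownarrow$ satisfies $|T|\le|S|$; (3) if $(S,T)\in\mathcal{RR}^\updownarrow$, $S\subseteq S'\subseteq E$ and $T'\subseteq T$, then $(S',T')\in\mathcal{RR}^\updownarrow$; (4) whenever $(S,T),(S',T')\in\mathcal{RR}^\updownarrow$ with $|T|-|S|>|T'|-|S'|$, there is $s'\in S'-S$ with $(S'-\{s'\},T')\in\mathcal{RR}^\updownarrow$ or there is $t\in T-T'$ with $(S',T'\cup\{t\})\in\mathcal{RR}^\updownarrow$.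
   Context: A bimatroid $\mathsf{A}$ on $E\times F$ is a set $\mathcal{R}(\mathsf{A})$ of pairs $(I,J)$, $I\subseteq E$, $J\subseteq F$, $|I|=|J|$ (regular minors), such that $(\emptyset,\emptyset)\in\mathcal{R}(\mathsf{A})$ and for all $(I,J),(I',J')\in\mathcal{R}(\mathsf{A})$: (a) for every $i'\in I'-I$, either some $i\in I-I'$ has $((I-\{i\})\cup\{i'\},J)\in\mathcal{R}(\mathsf{A})$, or some $j'\in J'-J$ has $(I\cup\{i'\},J\cup\{j'\})\in\mathcal{R}(\mathsf{A})$; (b) for every $j\in J-J'$, either some $j'\in J'-J$ has $(I,(J-\{j\})\cup\{j'\})\in\mathcal{R}(\mathsf{A})$, or some $i\in I-I'$ has $(I-\{i\},J-\{j\})\in\mathcal{R}(\mathsf{A})$. The relative rank $r_{\mathsf{A}}(S,T)$ is the largest $d$ such that some $(I,J)\in\mathcal{R}(\mathsf{A})$ with $|I|=d$ has $I\subseteq S$, $J\subseteq T$; $(S,T)\in 2^E\times 2^F$ is a vertical regular rectangle if $r_{\mathsf{A}}(S,T)=|T|\le|S|$. -}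

module Defs where

open import Data.Nat using (ℕ; _≤_; _<_; _+_)
open import Data.Bool using (Bool; true)
open import Data.Fin using (Fin)
open import Data.Fin.Subset using (Subset; _∈_; _∉_; _⊆_; _∪_; _-_; ⁅_⁆; ∣_∣)
  renaming (⊥ to ∅)
open import Data.Product using (Σ; _×_; ∃; ∃-syntax; _,_)
open import Data.Sum using (_⊎_)
open import Relation.Binary.PropositionalEquality using (_≡_)

-- Ground sets: E = Fin m, F = Fin n.  A family of pairs (S,T) ∈ 2^E × 2^F
-- is given by its (Boolean) characteristic function.
Family : ℕ → ℕ → Set
Family m n = Subset m → Subset n → Bool

_∈F_ : ∀ {m n} → Subset m × Subset n → Family m n → Set
(S , T) ∈F 𝓕 = 𝓕 S T ≡ true
infix 4 _∈F_

record IsBimatroid {m n : ℕ} (R : Family m n) : Set where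
  field
    size  : ∀ I J → (I , J) ∈F R → ∣ I ∣ ≡ ∣ J ∣
    empty : (∅ , ∅) ∈F R
    exchA : ∀ I J I' J' → (I , J) ∈F R → (I' , J') ∈F R →
            ∀ i' → i' ∈ I' → i' ∉ I →
              (∃[ i ] (i ∈ I × i ∉ I' × (((I - i) ∪ ⁅ i' ⁆) , J) ∈F R))
            ⊎ (∃[ j' ] (j' ∈ J' × j' ∉ J × ((I ∪ ⁅ i' ⁆) , (J ∪ ⁅ j' ⁆)) ∈F R))
    exchB : ∀ I J I' J' → (I , J) ∈F R → (I' , J') ∈F R →
            ∀ j → j ∈ J → j ∉ J' →
              (∃[ j' ] (j' ∈ J' × j' ∉ J × (I , ((J - j) ∪ ⁅ j' ⁆)) ∈F R))
            ⊎ (∃[ i ] (i ∈ I × i ∉ I' × ((I - i) , (J - j)) ∈F R))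

record Bimatroid (m n : ℕ) : Set where
  field
    minors      : Family m n
    isBimatroid : IsBimatroid minors
open Bimatroid public

IsRelRank : ∀ {m n} → Bimatroid m n → Subset m → Subset n → ℕ → Set
IsRelRank A S T d =
    (∃[ I ] ∃[ J ] ((I , J) ∈F minors A × I ⊆ S × J ⊆ T × ∣ I ∣ ≡ d))
  × (∀ I J → (I , J) ∈F minors A → I ⊆ S → J ⊆ T → ∣ I ∣ ≤ d)

VerticalRegularRectangle : ∀ {m n} → Bimatroid m n → Subset m → Subset n → Set
VerticalRegularRectangle A S T = IsRelRank A S T ∣ T ∣ × ∣ T ∣ ≤ ∣ S ∣

record VRRAxioms {m n : ℕ} (𝓡 : Family m n) : Set where
  field
    ax1 : (∅ , ∅) ∈F 𝓡
    ax2 : ∀ S T → (S , T) ∈F 𝓡 → ∣ T ∣ ≤ ∣ S ∣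
    ax3 : ∀ S T S' T' → (S , T) ∈F 𝓡 → S ⊆ S' → T' ⊆ T → (S' , T') ∈F 𝓡
    -- |T| - |S| > |T'| - |S'|  written as  |T'| + |S| < |T| + |S'|
    ax4 : ∀ S T S' T' → (S , T) ∈F 𝓡 → (S' , T') ∈F 𝓡 →
          ∣ T' ∣ + ∣ S ∣ < ∣ T ∣ + ∣ S' ∣ →
            (∃[ s' ] (s' ∈ S' × s' ∉ S × ((S' - s') , T') ∈F 𝓡))
          ⊎ (∃[ t ] (t ∈ T × t ∉ T' × (S' , (T' ∪ ⁅ t ⁆)) ∈F 𝓡))

-- A pair (S , T) is a vertical regular rectangle of a bimatroid exactly when some regular
-- minor (I , T) has I ⊆ S.  With this description, (1)–(3) follow from exchange axiom (b)
-- applied against (∅ , ∅), which removes any column of a regular minor together with some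
-- row.  For (4), take minors (I , T) and (I′ , T′) inside (S , T) and (S′ , T′), and use
-- exchange axiom (a) to move I′ towards I inside S′: every exchange either yields the
-- required element or strictly shrinks I ─ I′, and when no exchange is possible,
-- inclusion–exclusion gives |I| + |S′| ≤ |S| + |I′|, contradicting |T| − |S| > |T′| − |S′|.
--
-- Conversely, the square members of a family satisfying (1)–(4) form a bimatroid, since both
-- exchange axioms are instances of (4); and (4) applied against (∅ , ∅) shrinks every member
-- (S , T) to a square member (I , T) with I ⊆ S, so the vertical regular rectangles of this
-- bimatroid are exactly the members of the family.
module Submission where

open import Defs
open import Data.Nat using (ℕ; suc; _≤_; _<_; _+_; _≤?_; _≡ᵇ_; s≤s)
open import Data.Nat.Properties
  using (+-comm; +-suc; +-identityʳ; +-mono-≤; ≤-reflexive; ≤-antisym; ≤⇒≯; ≰⇒>;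
         suc-injective; ≡ᵇ⇒≡; ≡⇒≡ᵇ; module ≤-Reasoning)
open import Data.Nat.Induction using (<-wellFounded)
open import Data.Bool using (true; false; _∧_)
open import Data.Bool.Properties using (T-≡; T-∧)
open import Data.Fin using (zero; suc)
open import Data.Fin.Properties using (any?)
open import Data.Fin.Subset using (Subset; _∈_; _∉_; _⊆_; _∪_; _∩_; _─_; _-_; ⁅_⁆; ∣_∣)
  renaming (⊥ to ∅)
open import Data.Fin.Subset.Properties
  using (_∈?_; ⊆-refl; ⊆-trans; ⊆-antisym; p⊆q⇒∣p∣≤∣q∣; p⊂q⇒∣p∣<∣q∣; x∈⁅x⁆; x∈⁅y⁆⇒x≡y;
         x∉⁅y⁆⇒x≢y; ∉⊥; ∣⊥∣≡0; ∪-identityʳ; p─⊥≡p; p⊆p∪q; x∈p∪q⁺; x∈p∪q⁻; x∈p∩q⁺;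
         x∈p∩q⁻; drop-there; p─q⊆p; x∈p∧x∉q⇒x∈p─q; x∈p∧x≢y⇒x∈p-y; x∈p⇒∣p-x∣<∣p∣)
open import Data.Vec using ([]; _∷_; here; there)
open import Data.Product using (∃-syntax; _×_; _,_; proj₁; proj₂; map; map₁; map₂)
open import Data.Sum using (_⊎_; inj₁; inj₂; [_,_])
import Data.Sum as Sum
open import Data.Empty using (⊥-elim)
open import Function using (_∘_)
open import Function.Bundles using (_⇔_; mk⇔; Equivalence)
open import Function.Construct.Composition using (_⇔-∘_)
open import Induction.WellFounded using (Acc; acc)
open import Relation.Nullary using (yes; no)
open import Relation.Nullary.Decidable using (_×-dec_; ¬?; decidable-stable)
open import Relation.Binary.PropositionalEquality
  using (_≡_; _≢_; refl; sym; trans; cong; subst)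

open Equivalence using (to; from)

⊆⊎∃∉ : ∀ {n} (p q : Subset n) → p ⊆ q ⊎ ∃[ x ] (x ∈ p × x ∉ q)
⊆⊎∃∉ p q with any? (λ x → x ∈? p ×-dec ¬? (x ∈? q))
... | yes x∈p∖q = inj₂ x∈p∖q
... | no ∄ = inj₁ λ {x} x∈p → decidable-stable (x ∈? q) (λ x∉q → ∄ (x , x∈p , x∉q))

p⊆q∧∣q∣≤∣p∣⇒p≡q : ∀ {n} {p q : Subset n} → p ⊆ q → ∣ q ∣ ≤ ∣ p ∣ → p ≡ q
p⊆q∧∣q∣≤∣p∣⇒p≡q {p = p} {q} p⊆q ∣q∣≤∣p∣ with ⊆⊎∃∉ q p
... | inj₁ q⊆p = ⊆-antisym p⊆q q⊆p
... | inj₂ (x , x∈q , x∉p) = ⊥-elim (≤⇒≯ ∣q∣≤∣p∣ (p⊂q⇒∣p∣<∣q∣ (p⊆q , x , x∈q , x∉p)))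

x∈p─q⁻ : ∀ {n x} (p q : Subset n) → x ∈ p ─ q → x ∈ p × x ∉ q
x∈p─q⁻ {x = zero}  (true ∷ p)  (false ∷ q) here = here , λ ()
x∈p─q⁻ {x = zero}  (true ∷ p)  (true ∷ q)  ()
x∈p─q⁻ {x = zero}  (false ∷ p) (true ∷ q)  ()
x∈p─q⁻ {x = zero}  (false ∷ p) (false ∷ q) ()
x∈p─q⁻ {x = suc x} (_ ∷ p)     (_ ∷ q)     (there x∈p─q) =
  map there (λ x∉q → x∉q ∘ drop-there) (x∈p─q⁻ p q x∈p─q)

x∈p-y⁻ : ∀ {n x y} {p : Subset n} → x ∈ p - y → x ∈ p × x ≢ y
x∈p-y⁻ {y = y} {p} = map₂ x∉⁅y⁆⇒x≢y ∘ x∈p─q⁻ p ⁅ y ⁆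

x∈p∪⁅x⁆ : ∀ {n} x (p : Subset n) → x ∈ p ∪ ⁅ x ⁆
x∈p∪⁅x⁆ x p = x∈p∪q⁺ (inj₂ (x∈⁅x⁆ x))

p⊆q∧x∈q⇒p∪⁅x⁆⊆q : ∀ {n x} {p q : Subset n} → p ⊆ q → x ∈ q → p ∪ ⁅ x ⁆ ⊆ q
p⊆q∧x∈q⇒p∪⁅x⁆⊆q {x = x} {p} p⊆q x∈q y∈ with x∈p∪q⁻ p ⁅ x ⁆ y∈
... | inj₁ y∈p = p⊆q y∈p
... | inj₂ y∈⁅x⁆ = subst (_∈ _) (sym (x∈⁅y⁆⇒x≡y x y∈⁅x⁆)) x∈q

p⊆q∧x∉p⇒p⊆q-x : ∀ {n x} {p q : Subset n} → p ⊆ q → x ∉ p → p ⊆ q - x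
p⊆q∧x∉p⇒p⊆q-x {p = p} p⊆q x∉p y∈p =
  x∈p∧x≢y⇒x∈p-y (p⊆q y∈p) (λ y≡x → x∉p (subst (_∈ p) y≡x y∈p))

[p∪⁅x⁆]-y⊆[p-y]∪⁅x⁆ : ∀ {n x y} {p : Subset n} → (p ∪ ⁅ x ⁆) - y ⊆ (p - y) ∪ ⁅ x ⁆
[p∪⁅x⁆]-y⊆[p-y]∪⁅x⁆ {x = x} {p = p} z∈ with x∈p-y⁻ z∈
... | z∈p∪⁅x⁆ , z≢y =
  [ (λ z∈p → x∈p∪q⁺ (inj₁ (x∈p∧x≢y⇒x∈p-y z∈p z≢y))) , x∈p∪q⁺ ∘ inj₂ ] (x∈p∪q⁻ p ⁅ x ⁆ z∈p∪⁅x⁆)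

∣p∪⁅x⁆∣≡1+∣p∣ : ∀ {n x} {p : Subset n} → x ∉ p → ∣ p ∪ ⁅ x ⁆ ∣ ≡ suc ∣ p ∣
∣p∪⁅x⁆∣≡1+∣p∣ {x = zero}  {false ∷ p} x∉p = cong (suc ∘ ∣_∣) (∪-identityʳ p)
∣p∪⁅x⁆∣≡1+∣p∣ {x = zero}  {true ∷ p}  x∉p = ⊥-elim (x∉p here)
∣p∪⁅x⁆∣≡1+∣p∣ {x = suc x} {true ∷ p}  x∉p = cong suc (∣p∪⁅x⁆∣≡1+∣p∣ (x∉p ∘ there))
∣p∪⁅x⁆∣≡1+∣p∣ {x = suc x} {false ∷ p} x∉p = ∣p∪⁅x⁆∣≡1+∣p∣ (x∉p ∘ there)

1+∣p-x∣≡∣p∣ : ∀ {n x} {p : Subset n} → x ∈ p → suc ∣ p - x ∣ ≡ ∣ p ∣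
1+∣p-x∣≡∣p∣ {x = zero}  {true ∷ p}  here        = cong (suc ∘ ∣_∣) (p─⊥≡p p)
1+∣p-x∣≡∣p∣ {x = suc x} {true ∷ p}  (there x∈p) = cong suc (1+∣p-x∣≡∣p∣ x∈p)
1+∣p-x∣≡∣p∣ {x = suc x} {false ∷ p} (there x∈p) = 1+∣p-x∣≡∣p∣ x∈p

∣[p-x]∪⁅y⁆∣≡∣p∣ : ∀ {n x y} {p : Subset n} → x ∈ p → y ∉ p → ∣ (p - x) ∪ ⁅ y ⁆ ∣ ≡ ∣ p ∣
∣[p-x]∪⁅y⁆∣≡∣p∣ {x = x} {p = p} x∈p y∉p =
  trans (∣p∪⁅x⁆∣≡1+∣p∣ (y∉p ∘ p─q⊆p p ⁅ x ⁆)) (1+∣p-x∣≡∣p∣ x∈p)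

∣p∪q∣+∣p∩q∣≡∣p∣+∣q∣ : ∀ {n} (p q : Subset n) → ∣ p ∪ q ∣ + ∣ p ∩ q ∣ ≡ ∣ p ∣ + ∣ q ∣
∣p∪q∣+∣p∩q∣≡∣p∣+∣q∣ [] [] = refl
∣p∪q∣+∣p∩q∣≡∣p∣+∣q∣ (true ∷ p) (true ∷ q) =
  cong suc (trans (+-suc _ _) (trans (cong suc (∣p∪q∣+∣p∩q∣≡∣p∣+∣q∣ p q)) (sym (+-suc _ _))))
∣p∪q∣+∣p∩q∣≡∣p∣+∣q∣ (true ∷ p) (false ∷ q) = cong suc (∣p∪q∣+∣p∩q∣≡∣p∣+∣q∣ p q)
∣p∪q∣+∣p∩q∣≡∣p∣+∣q∣ (false ∷ p) (true ∷ q) =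
  trans (cong suc (∣p∪q∣+∣p∩q∣≡∣p∣+∣q∣ p q)) (sym (+-suc _ _))
∣p∪q∣+∣p∩q∣≡∣p∣+∣q∣ (false ∷ p) (false ∷ q) = ∣p∪q∣+∣p∩q∣≡∣p∣+∣q∣ p q

∣p∣+∣q∣≤∣r∣+∣s∣ : ∀ {n} {p q r s : Subset n} →
                  p ⊆ r → q ⊆ r ∪ s → p ∩ q ⊆ s → ∣ p ∣ + ∣ q ∣ ≤ ∣ r ∣ + ∣ s ∣
∣p∣+∣q∣≤∣r∣+∣s∣ {p = p} {q} {r} {s} p⊆r q⊆r∪s p∩q⊆s = begin
  ∣ p ∣ + ∣ q ∣         ≡⟨ ∣p∪q∣+∣p∩q∣≡∣p∣+∣q∣ p q ⟨
  ∣ p ∪ q ∣ + ∣ p ∩ q ∣ ≤⟨ +-mono-≤ (p⊆q⇒∣p∣≤∣q∣ p∪q⊆r∪s) (p⊆q⇒∣p∣≤∣q∣ p∩q⊆r∩s) ⟩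
  ∣ r ∪ s ∣ + ∣ r ∩ s ∣ ≡⟨ ∣p∪q∣+∣p∩q∣≡∣p∣+∣q∣ r s ⟩
  ∣ r ∣ + ∣ s ∣         ∎
  where
  open ≤-Reasoning
  p∪q⊆r∪s : p ∪ q ⊆ r ∪ s
  p∪q⊆r∪s = [ x∈p∪q⁺ ∘ inj₁ ∘ p⊆r , q⊆r∪s ] ∘ x∈p∪q⁻ p q
  p∩q⊆r∩s : p ∩ q ⊆ r ∩ s
  p∩q⊆r∩s x∈p∩q = x∈p∩q⁺ (p⊆r (proj₁ (x∈p∩q⁻ p q x∈p∩q)) , p∩q⊆s x∈p∩q)

∣p─[q-y∪⁅x⁆]∣<∣p─q∣ : ∀ {n x y} {p q : Subset n} → x ∈ p → x ∉ q → y ∉ p →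
                      ∣ p ─ ((q - y) ∪ ⁅ x ⁆) ∣ < ∣ p ─ q ∣
∣p─[q-y∪⁅x⁆]∣<∣p─q∣ {x = x} {y} {p} {q} x∈p x∉q y∉p =
  p⊂q⇒∣p∣<∣q∣ (shrinks , x , x∈p∧x∉q⇒x∈p─q x∈p x∉q ,
               λ x∈ → proj₂ (x∈p─q⁻ p _ x∈) (x∈p∪⁅x⁆ x (q - y)))
  where
  shrinks : p ─ ((q - y) ∪ ⁅ x ⁆) ⊆ p ─ q
  shrinks z∈ with x∈p─q⁻ p _ z∈
  ... | z∈p , z∉q′ = x∈p∧x∉q⇒x∈p─q z∈p λ z∈q →
    z∉q′ (x∈p∪q⁺ (inj₁ (x∈p∧x≢y⇒x∈p-y z∈q (λ z≡y → y∉p (subst (_∈ p) z≡y z∈p)))))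

m+n<n+1+m : ∀ m n → m + n < n + suc m
m+n<n+1+m m n = subst (m + n <_) (sym (+-suc n m)) (s≤s (≤-reflexive (+-comm m n)))

HasRegularMinor : ∀ {m n} → Family m n → Subset m → Subset n → Set
HasRegularMinor R S T = ∃[ I ] (I ⊆ S × (I , T) ∈F R)

hasRegularMinor-⊆ : ∀ {m n} (R : Family m n) {S S′ T} → S ⊆ S′ →
                    HasRegularMinor R S T → HasRegularMinor R S′ T
hasRegularMinor-⊆ R S⊆S′ = map₂ (map₁ (λ I⊆S → ⊆-trans I⊆S S⊆S′))

module _ {m n} (A : Bimatroid m n) where

  open IsBimatroid (isBimatroid A)

  vrr⇔hasRegularMinor : ∀ {S T} →
                        VerticalRegularRectangle A S T ⇔ HasRegularMinor (minors A) S T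
  vrr⇔hasRegularMinor {S} {T} = mk⇔ toMinor fromMinor
    where
    toMinor : VerticalRegularRectangle A S T → HasRegularMinor (minors A) S T
    toMinor (((I , J , r , I⊆S , J⊆T , ∣I∣≡∣T∣) , _) , _) =
      I , I⊆S , subst (λ J → (I , J) ∈F minors A) J≡T r
      where
      J≡T : J ≡ T
      J≡T = p⊆q∧∣q∣≤∣p∣⇒p≡q J⊆T (≤-reflexive (trans (sym ∣I∣≡∣T∣) (size I J r)))
    fromMinor : HasRegularMinor (minors A) S T → VerticalRegularRectangle A S T
    fromMinor (I , I⊆S , r) =
      ((I , T , r , I⊆S , ⊆-refl , size I T r) , maximal) ,
      subst (_≤ ∣ S ∣) (size I T r) (p⊆q⇒∣p∣≤∣q∣ I⊆S)
      where
      maximal : ∀ I′ J′ → (I′ , J′) ∈F minors A → I′ ⊆ S → J′ ⊆ T → ∣ I′ ∣ ≤ ∣ T ∣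
      maximal I′ J′ r′ _ J′⊆T = subst (_≤ ∣ T ∣) (sym (size I′ J′ r′)) (p⊆q⇒∣p∣≤∣q∣ J′⊆T)

  removeColumn : ∀ {I J j} → (I , J) ∈F minors A → j ∈ J →
                 ∃[ i ] (i ∈ I × (I - i , J - j) ∈F minors A)
  removeColumn {I} {J} {j} r j∈J with exchB I J ∅ ∅ r empty j j∈J ∉⊥
  ... | inj₁ (_ , j′∈∅ , _) = ⊥-elim (∉⊥ j′∈∅)
  ... | inj₂ (i , i∈I , _ , r′) = i , i∈I , r′

  restrictColumns : ∀ {I T T′} → Acc _<_ ∣ T ∣ → (I , T) ∈F minors A → T′ ⊆ T →
                    HasRegularMinor (minors A) I T′
  restrictColumns {I} {T} {T′} (acc rec) r T′⊆T with ⊆⊎∃∉ T T′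
  ... | inj₁ T⊆T′ = I , ⊆-refl , subst (λ J → (I , J) ∈F minors A) (⊆-antisym T⊆T′ T′⊆T) r
  ... | inj₂ (j , j∈T , j∉T′) with removeColumn r j∈T
  ... | i , _ , r′ = hasRegularMinor-⊆ (minors A) (p─q⊆p I ⁅ i ⁆)
                       (restrictColumns (rec (x∈p⇒∣p-x∣<∣p∣ j∈T)) r′ (p⊆q∧x∉p⇒p⊆q-x T′⊆T j∉T′))

  hasRegularMinor-mono : ∀ {S S′ T T′} → HasRegularMinor (minors A) S T → S ⊆ S′ → T′ ⊆ T →
                         HasRegularMinor (minors A) S′ T′
  hasRegularMinor-mono (I , I⊆S , r) S⊆S′ T′⊆T =
    hasRegularMinor-⊆ (minors A) (⊆-trans I⊆S S⊆S′) (restrictColumns (<-wellFounded _) r T′⊆T)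

  augment : ∀ {S T S′ T′} →
            HasRegularMinor (minors A) S T → HasRegularMinor (minors A) S′ T′ →
            ∣ T′ ∣ + ∣ S ∣ < ∣ T ∣ + ∣ S′ ∣ →
              (∃[ s′ ] (s′ ∈ S′ × s′ ∉ S × HasRegularMinor (minors A) (S′ - s′) T′))
            ⊎ (∃[ t ] (t ∈ T × t ∉ T′ × HasRegularMinor (minors A) S′ (T′ ∪ ⁅ t ⁆)))
  augment {S} {T} {S′} {T′} (I , I⊆S , rI) (I₀ , I₀⊆S′ , rI₀) lt =
    loop (<-wellFounded _) I₀⊆S′ rI₀
    where
    Goal : Set
    Goal = (∃[ s′ ] (s′ ∈ S′ × s′ ∉ S × HasRegularMinor (minors A) (S′ - s′) T′))
         ⊎ (∃[ t ] (t ∈ T × t ∉ T′ × HasRegularMinor (minors A) S′ (T′ ∪ ⁅ t ⁆)))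

    -- The exchanged-out row i₀ need not be tested against S: if i₀ ∉ S, the next round
    -- finds it in S′ ─ (S ∪ I′) and stops there.
    loop : ∀ {I′} → Acc _<_ ∣ I ─ I′ ∣ → I′ ⊆ S′ → (I′ , T′) ∈F minors A → Goal
    loop {I′} (acc rec) I′⊆S′ rI′ with ⊆⊎∃∉ S′ (S ∪ I′)
    ... | inj₂ (s , s∈S′ , s∉S∪I′) =
      inj₁ (s , s∈S′ , s∉S∪I′ ∘ x∈p∪q⁺ ∘ inj₁ ,
            I′ , p⊆q∧x∉p⇒p⊆q-x I′⊆S′ (s∉S∪I′ ∘ x∈p∪q⁺ ∘ inj₂) , rI′)
    ... | inj₁ S′⊆S∪I′ with ⊆⊎∃∉ (I ∩ S′) I′
    ...   | inj₁ I∩S′⊆I′ = ⊥-elim (≤⇒≯ counted lt)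
      where
      open ≤-Reasoning
      counted : ∣ T ∣ + ∣ S′ ∣ ≤ ∣ T′ ∣ + ∣ S ∣
      counted = begin
        ∣ T ∣ + ∣ S′ ∣  ≡⟨ cong (_+ ∣ S′ ∣) (size I T rI) ⟨
        ∣ I ∣ + ∣ S′ ∣  ≤⟨ ∣p∣+∣q∣≤∣r∣+∣s∣ I⊆S S′⊆S∪I′ I∩S′⊆I′ ⟩
        ∣ S ∣ + ∣ I′ ∣  ≡⟨ +-comm ∣ S ∣ ∣ I′ ∣ ⟩
        ∣ I′ ∣ + ∣ S ∣  ≡⟨ cong (_+ ∣ S ∣) (size I′ T′ rI′) ⟩
        ∣ T′ ∣ + ∣ S ∣  ∎
    ...   | inj₂ (i , i∈I∩S′ , i∉I′) with x∈p∩q⁻ I S′ i∈I∩S′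
    ...     | i∈I , i∈S′ with exchA I′ T′ I T rI′ rI i i∈I i∉I′
    ...       | inj₂ (t , t∈T , t∉T′ , r) =
      inj₂ (t , t∈T , t∉T′ , I′ ∪ ⁅ i ⁆ , p⊆q∧x∈q⇒p∪⁅x⁆⊆q I′⊆S′ i∈S′ , r)
    ...       | inj₁ (i₀ , _ , i₀∉I , r) =
      loop (rec (∣p─[q-y∪⁅x⁆]∣<∣p─q∣ i∈I i∉I′ i₀∉I))
           (p⊆q∧x∈q⇒p∪⁅x⁆⊆q (⊆-trans (p─q⊆p I′ ⁅ i₀ ⁆) I′⊆S′) i∈S′) r

vrrAxioms : ∀ {m n} {𝓡 : Family m n} (A : Bimatroid m n) →
            (∀ S T → VerticalRegularRectangle A S T ⇔ (S , T) ∈F 𝓡) → VRRAxioms 𝓡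
vrrAxioms {𝓡 = 𝓡} A vrr⇔𝓡 = record
  { ax1 = toFamily (∅ , ⊆-refl , IsBimatroid.empty (isBimatroid A))
  ; ax2 = λ S T → proj₂ ∘ from (vrr⇔𝓡 S T)
  ; ax3 = λ S T S′ T′ r S⊆S′ T′⊆T →
      toFamily (hasRegularMinor-mono A (fromFamily r) S⊆S′ T′⊆T)
  ; ax4 = λ S T S′ T′ r r′ lt →
      Sum.map (map₂ (map₂ (map₂ toFamily))) (map₂ (map₂ (map₂ toFamily)))
              (augment A (fromFamily r) (fromFamily r′) lt)
  }
  where
  toFamily : ∀ {S T} → HasRegularMinor (minors A) S T → (S , T) ∈F 𝓡
  toFamily {S} {T} = to (vrr⇔𝓡 S T) ∘ from (vrr⇔hasRegularMinor A)
  fromFamily : ∀ {S T} → (S , T) ∈F 𝓡 → HasRegularMinor (minors A) S T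
  fromFamily {S} {T} = to (vrr⇔hasRegularMinor A) ∘ from (vrr⇔𝓡 S T)

squarePart : ∀ {m n} → Family m n → Family m n
squarePart 𝓡 I J = 𝓡 I J ∧ (∣ I ∣ ≡ᵇ ∣ J ∣)

∈squarePart⇔ : ∀ {m n} (𝓡 : Family m n) {I J} →
               (I , J) ∈F squarePart 𝓡 ⇔ ((I , J) ∈F 𝓡 × ∣ I ∣ ≡ ∣ J ∣)
∈squarePart⇔ 𝓡 {I} {J} = mk⇔
  (λ r → map (to T-≡) (≡ᵇ⇒≡ ∣ I ∣ ∣ J ∣) (to T-∧ (from T-≡ r)))
  (λ (r , e) → to T-≡ (from T-∧ (from T-≡ r , ≡⇒≡ᵇ ∣ I ∣ ∣ J ∣ e)))

module _ {m n} {𝓡 : Family m n} (ax : VRRAxioms 𝓡) where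

  open VRRAxioms ax

  squarePart-exchA : ∀ I J I′ J′ → (I , J) ∈F squarePart 𝓡 → (I′ , J′) ∈F squarePart 𝓡 →
      ∀ i′ → i′ ∈ I′ → i′ ∉ I →
        (∃[ i ] (i ∈ I × i ∉ I′ × (((I - i) ∪ ⁅ i′ ⁆) , J) ∈F squarePart 𝓡))
      ⊎ (∃[ j′ ] (j′ ∈ J′ × j′ ∉ J × ((I ∪ ⁅ i′ ⁆) , (J ∪ ⁅ j′ ⁆)) ∈F squarePart 𝓡))
  squarePart-exchA I J I′ J′ r r′ i′ i′∈I′ i′∉I
    with to (∈squarePart⇔ 𝓡) r | to (∈squarePart⇔ 𝓡) r′
  ... | rIJ , ∣I∣≡∣J∣ | rI′J′ , ∣I′∣≡∣J′∣
    with ax4 I′ J′ (I ∪ ⁅ i′ ⁆) J rI′J′ (ax3 I J (I ∪ ⁅ i′ ⁆) J rIJ (p⊆p∪q ⁅ i′ ⁆) ⊆-refl) lt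
    where
    lt : ∣ J ∣ + ∣ I′ ∣ < ∣ J′ ∣ + ∣ I ∪ ⁅ i′ ⁆ ∣
    lt rewrite ∣I′∣≡∣J′∣ | ∣p∪⁅x⁆∣≡1+∣p∣ i′∉I | ∣I∣≡∣J∣ = m+n<n+1+m ∣ J ∣ ∣ J′ ∣
  ... | inj₂ (j′ , j′∈J′ , j′∉J , r₂) =
    inj₂ (j′ , j′∈J′ , j′∉J , from (∈squarePart⇔ 𝓡) (r₂ , sizes))
    where
    sizes : ∣ I ∪ ⁅ i′ ⁆ ∣ ≡ ∣ J ∪ ⁅ j′ ⁆ ∣
    sizes = trans (∣p∪⁅x⁆∣≡1+∣p∣ i′∉I) (trans (cong suc ∣I∣≡∣J∣) (sym (∣p∪⁅x⁆∣≡1+∣p∣ j′∉J)))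
  ... | inj₁ (i , i∈I∪⁅i′⁆ , i∉I′ , r₂) =
    inj₁ (i , i∈I , i∉I′ , from (∈squarePart⇔ 𝓡)
                              ( ax3 _ J _ J r₂ [p∪⁅x⁆]-y⊆[p-y]∪⁅x⁆ ⊆-refl
                              , trans (∣[p-x]∪⁅y⁆∣≡∣p∣ i∈I i′∉I) ∣I∣≡∣J∣))
    where
    i≢i′ : i ≢ i′
    i≢i′ i≡i′ = i∉I′ (subst (_∈ I′) (sym i≡i′) i′∈I′)
    i∈I : i ∈ I
    i∈I = [ (λ i∈I → i∈I) , ⊥-elim ∘ i≢i′ ∘ x∈⁅y⁆⇒x≡y i′ ] (x∈p∪q⁻ I ⁅ i′ ⁆ i∈I∪⁅i′⁆)

  squarePart-exchB : ∀ I J I′ J′ → (I , J) ∈F squarePart 𝓡 → (I′ , J′) ∈F squarePart 𝓡 →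
      ∀ j → j ∈ J → j ∉ J′ →
        (∃[ j′ ] (j′ ∈ J′ × j′ ∉ J × (I , ((J - j) ∪ ⁅ j′ ⁆)) ∈F squarePart 𝓡))
      ⊎ (∃[ i ] (i ∈ I × i ∉ I′ × ((I - i) , (J - j)) ∈F squarePart 𝓡))
  squarePart-exchB I J I′ J′ r r′ j j∈J j∉J′
    with to (∈squarePart⇔ 𝓡) r | to (∈squarePart⇔ 𝓡) r′
  ... | rIJ , ∣I∣≡∣J∣ | rI′J′ , ∣I′∣≡∣J′∣
    with ax4 I′ J′ I (J - j) rI′J′ (ax3 I J I (J - j) rIJ ⊆-refl (p─q⊆p J ⁅ j ⁆)) lt
    where
    lt : ∣ J - j ∣ + ∣ I′ ∣ < ∣ J′ ∣ + ∣ I ∣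
    lt rewrite ∣I′∣≡∣J′∣ | ∣I∣≡∣J∣ | sym (1+∣p-x∣≡∣p∣ j∈J) = m+n<n+1+m ∣ J - j ∣ ∣ J′ ∣
  ... | inj₁ (i , i∈I , i∉I′ , r₂) =
    inj₂ (i , i∈I , i∉I′ , from (∈squarePart⇔ 𝓡) (r₂ , sizes))
    where
    sizes : ∣ I - i ∣ ≡ ∣ J - j ∣
    sizes = suc-injective (trans (1+∣p-x∣≡∣p∣ i∈I) (trans ∣I∣≡∣J∣ (sym (1+∣p-x∣≡∣p∣ j∈J))))
  ... | inj₂ (j′ , j′∈J′ , j′∉J-j , r₂) =
    inj₁ (j′ , j′∈J′ , j′∉J , from (∈squarePart⇔ 𝓡)
                                (r₂ , trans ∣I∣≡∣J∣ (sym (∣[p-x]∪⁅y⁆∣≡∣p∣ j∈J j′∉J))))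
    where
    j′∉J : j′ ∉ J
    j′∉J j′∈J = j′∉J-j (x∈p∧x≢y⇒x∈p-y j′∈J (λ j′≡j → j∉J′ (subst (_∈ J′) j′≡j j′∈J′)))

  bimatroidOf : Bimatroid m n
  bimatroidOf = record
    { minors      = squarePart 𝓡
    ; isBimatroid = record
      { size  = λ I J → proj₂ ∘ to (∈squarePart⇔ 𝓡)
      ; empty = from (∈squarePart⇔ 𝓡) (ax1 , trans (∣⊥∣≡0 m) (sym (∣⊥∣≡0 n)))
      ; exchA = squarePart-exchA
      ; exchB = squarePart-exchB
      }
    }

  shrinkRows : ∀ {S T} → Acc _<_ ∣ S ∣ → (S , T) ∈F 𝓡 → HasRegularMinor (squarePart 𝓡) S T
  shrinkRows {S} {T} (acc rec) r with ∣ S ∣ ≤? ∣ T ∣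
  ... | yes ∣S∣≤∣T∣ = S , ⊆-refl , from (∈squarePart⇔ 𝓡) (r , ≤-antisym ∣S∣≤∣T∣ (ax2 S T r))
  ... | no ∣S∣≰∣T∣ with ax4 ∅ ∅ S T ax1 r lt
    where
    lt : ∣ T ∣ + ∣ ∅ {m} ∣ < ∣ ∅ {n} ∣ + ∣ S ∣
    lt rewrite ∣⊥∣≡0 m | ∣⊥∣≡0 n | +-identityʳ ∣ T ∣ = ≰⇒> ∣S∣≰∣T∣
  ...   | inj₂ (_ , t∈∅ , _) = ⊥-elim (∉⊥ t∈∅)
  ...   | inj₁ (s , s∈S , _ , r′) =
    hasRegularMinor-⊆ (squarePart 𝓡) (p─q⊆p S ⁅ s ⁆) (shrinkRows (rec (x∈p⇒∣p-x∣<∣p∣ s∈S)) r′)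

  hasRegularMinor⇔𝓡 : ∀ {S T} → HasRegularMinor (squarePart 𝓡) S T ⇔ (S , T) ∈F 𝓡
  hasRegularMinor⇔𝓡 {S} {T} = mk⇔
    (λ (I , I⊆S , r) → ax3 I T S T (proj₁ (to (∈squarePart⇔ 𝓡) r)) I⊆S ⊆-refl)
    (shrinkRows (<-wellFounded _))

corollary2p10 : (m n : ℕ) (𝓡 : Family m n) →
    (∃[ A ] (∀ (S : Subset m) (T : Subset n) → (VerticalRegularRectangle A S T ⇔ (S , T) ∈F 𝓡)))
      ⇔ VRRAxioms 𝓡
corollary2p10 m n 𝓡 = mk⇔
  (λ (A , vrr⇔𝓡) → vrrAxioms A vrr⇔𝓡)
  (λ ax → bimatroidOf ax , λ S T → hasRegularMinor⇔𝓡 ax ⇔-∘ vrr⇔hasRegularMinor (bimatroidOf ax))
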